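{- Let $\chi_0,\chi_1$ be PDL formulas, $\beta$ a PDL program, and $x$ an atomic proposition not occurring in $\beta$ (it may occur in $\chi_0,\chi_1$), such that $\lnot[\beta]\lnot x\equiv(x\land\chi_0)\lor\chi_1$. Then for any PDL formulas $\rho$ and $\psi$ such that $\chi_1[\rho/x]\models\rho$ and $\lnot\psi\models\rho$, we have $\lnot[\beta^\ast]\psi\models\rho$.
   Context: PDL syntax $\phi ::= \bot \mid p \mid \lnot\phi \mid \phi\land\phi \mid [\alpha]\phi$, $\alpha ::= a \mid \tau? \mid \alpha\cup\beta \mid \alpha;\beta \mid \alpha^\ast$ with standard Kripke semantics ($R_{\alpha^\ast}$ the reflexive-transitive closure of $R_\alpha$). $\phi\models\psi$: at every state of every Kripke model where $\phi$ is true, $\psi$ is true; $\equiv$ is semantic equivalence. $\chi[\rho/x]$ denotes uniform substitution of $\rho$ for $x$ in $\chi$. -}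

module Defs where

open import Data.Nat using (ℕ)
import Data.Nat
import Relation.Nullary
open import Data.Bool using (Bool; true)
open import Data.Empty using (⊥)
open import Data.Product using (_×_; Σ)
open import Data.Sum using (_⊎_)
open import Relation.Binary.PropositionalEquality using (_≡_)
open import Relation.Binary.Construct.Closure.ReflexiveTransitive using (Star)

Atom : Set
Atom = ℕ

Act : Set
Act = ℕ

infixr 6 _∧′_
mutual
  data Fml : Set where
    ⊥′   : Fml
    var  : Atom → Fml
    ¬′_  : Fml → Fml
    _∧′_ : Fml → Fml → Fml
    [_]_ : Prog → Fml → Fml

  data Prog : Set where
    act  : Act → Prog
    _¿   : Fml → Prog
    _∪′_ : Prog → Prog → Prog
    _⨾_  : Prog → Prog → Prog
    _*   : Prog → Prog

_∨′_ : Fml → Fml → Fml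
φ ∨′ ψ = ¬′ (¬′ φ ∧′ ¬′ ψ)

record Model : Set₁ where
  field
    W : Set
    R : Act → W → W → Set
    V : Atom → W → Bool

open Model public

mutual
  _,_⊨_ : (M : Model) → W M → Fml → Set
  M , w ⊨ ⊥′ = ⊥
  M , w ⊨ var p = V M p w ≡ true
  M , w ⊨ (¬′ φ) = M , w ⊨ φ → ⊥
  M , w ⊨ (φ ∧′ ψ) = (M , w ⊨ φ) × (M , w ⊨ ψ)
  M , w ⊨ ([ α ] φ) = ∀ v → Rel M α w v → M , v ⊨ φ

  Rel : (M : Model) → Prog → W M → W M → Set
  Rel M (act a) w v = R M a w v
  Rel M (τ ¿) w v = (w ≡ v) × (M , w ⊨ τ)
  Rel M (α ∪′ β) w v = Rel M α w v ⊎ Rel M β w v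
  Rel M (α ⨾ β) w v = Σ (W M) λ u → Rel M α w u × Rel M β u v
  Rel M (α *) w v = Star (Rel M α) w v

_⊨ᶠ_ : Fml → Fml → Set₁
φ ⊨ᶠ ψ = (M : Model) (w : W M) → M , w ⊨ φ → M , w ⊨ ψ

_≡ᶠ_ : Fml → Fml → Set₁
φ ≡ᶠ ψ = (φ ⊨ᶠ ψ) × (ψ ⊨ᶠ φ)

mutual
  OccF : Atom → Fml → Set
  OccF x ⊥′ = ⊥
  OccF x (var p) = x ≡ p
  OccF x (¬′ φ) = OccF x φ
  OccF x (φ ∧′ ψ) = OccF x φ ⊎ OccF x ψ
  OccF x ([ α ] φ) = OccP x α ⊎ OccF x φ

  OccP : Atom → Prog → Set
  OccP x (act a) = ⊥
  OccP x (τ ¿) = OccF x τ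
  OccP x (α ∪′ β) = OccP x α ⊎ OccP x β
  OccP x (α ⨾ β) = OccP x α ⊎ OccP x β
  OccP x (α *) = OccP x α

mutual
  substF : Fml → Fml → Atom → Fml
  substF ⊥′ ρ x = ⊥′
  substF (var p) ρ x with Data.Nat._≟_ x p
  ... | Relation.Nullary.yes _ = ρ
  ... | Relation.Nullary.no _ = var p
  substF (¬′ φ) ρ x = ¬′ substF φ ρ x
  substF (φ ∧′ ψ) ρ x = substF φ ρ x ∧′ substF ψ ρ x
  substF ([ α ] φ) ρ x = [ substP α ρ x ] substF φ ρ x

  substP : Prog → Fml → Atom → Prog
  substP (act a) ρ x = act a
  substP (τ ¿) ρ x = substF τ ρ x ¿
  substP (α ∪′ β) ρ x = substP α ρ x ∪′ substP β ρ x
  substP (α ⨾ β) ρ x = substP α ρ x ⨾ substP β ρ x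
  substP (α *) ρ x = substP α ρ x *

{-# OPTIONS --safe #-}
-- Substituting ρ for x in the hypothesis ⟨β⟩x ⊨ (x ∧ χ₀) ∨ χ₁ gives
-- ⟨β⟩ρ ⊨ (ρ ∧ χ₀[ρ/x]) ∨ χ₁[ρ/x], as x does not occur in β; since χ₁[ρ/x] ⊨ ρ,
-- this is ⟨β⟩ρ ⊨ ρ. So ρ is a prefixed point of ⟨β⟩ lying above ¬ψ, and the
-- induction principle of β* gives ⟨β*⟩¬ψ ⊨ ρ.
module Submission where

open import Defs
open import Data.Bool using (Bool; true)
open import Data.Bool.Properties using () renaming (_≟_ to _≟ᵇ_)
open import Data.Empty using (⊥-elim)
open import Data.Nat using (_≟_)
open import Data.Nat.Properties using (≟-diag)
open import Data.Product using (Σ; _,_; proj₁; proj₂)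
open import Data.Sum using (inj₁; inj₂)
open import Effect.Monad using (RawMonad)
open import Function using (_∘_; id)
open import Level using (0ℓ)
open import Relation.Nullary using (¬_; Dec; yes; no; does; Stable)
open import Relation.Nullary.Decidable using (decidable-stable; dec-true; ¬¬-excluded-middle)
open import Relation.Nullary.Negation using (¬¬-Monad; ¬¬-map; negated-stable)
open import Relation.Binary.PropositionalEquality using (_≡_; refl; cong; cong₂; subst; sym)
open import Relation.Binary.Construct.Closure.ReflexiveTransitive using (Star; ε; _◅_; fold)

⊨-stable : (M : Model) (w : W M) (φ : Fml) → Stable (M , w ⊨ φ)
⊨-stable M w ⊥′ ¬¬⊥ = ¬¬⊥ id
⊨-stable M w (var p) = decidable-stable (V M p w ≟ᵇ true)
⊨-stable M w (¬′ φ) = negated-stable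
⊨-stable M w (φ ∧′ ψ) ¬¬φ∧ψ =
  ⊨-stable M w φ (¬¬-map proj₁ ¬¬φ∧ψ) , ⊨-stable M w ψ (¬¬-map proj₂ ¬¬φ∧ψ)
⊨-stable M w ([ α ] φ) ¬¬□φ v r = ⊨-stable M v φ (¬¬-map (λ □φ → □φ v r) ¬¬□φ)

Star-backward-closed : ∀ {a r p} {A : Set a} {R : A → A → Set r} (P : A → Set p) →
                       (∀ {u v} → R u v → P v → P u) → ∀ {u v} → Star R u v → P v → P u
Star-backward-closed P step = fold (λ u v → P v → P u) (λ r k → step r ∘ k) id

star-induction : (β : Prog) (ρ ψ : Fml) →
                 (¬′ ([ β ] (¬′ ρ))) ⊨ᶠ ρ → (¬′ ψ) ⊨ᶠ ρ → (¬′ ([ β * ] ψ)) ⊨ᶠ ρ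
star-induction β ρ ψ ⟨β⟩ρ⊨ρ ¬ψ⊨ρ M w ⟨β*⟩¬ψ =
  ⊨-stable M w ρ λ ¬ρ → ⟨β*⟩¬ψ λ v path → ⊨-stable M v ψ λ ¬ψ →
    ¬ρ (Star-backward-closed (M ,_⊨ ρ) ρ-backward path (¬ψ⊨ρ M v ¬ψ))
  where
  ρ-backward : ∀ {u v} → Rel M β u v → M , v ⊨ ρ → M , u ⊨ ρ
  ρ-backward r ρv = ⟨β⟩ρ⊨ρ M _ λ □¬ρ → □¬ρ _ r ρv

module _ (ρ : Fml) (x : Atom) where

  mutual
    substF-fresh : (φ : Fml) → ¬ OccF x φ → substF φ ρ x ≡ φ
    substF-fresh ⊥′ x∉φ = refl
    substF-fresh (var p) x∉φ with x ≟ p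
    ... | yes x≡p = ⊥-elim (x∉φ x≡p)
    ... | no _ = refl
    substF-fresh (¬′ φ) x∉φ = cong ¬′_ (substF-fresh φ x∉φ)
    substF-fresh (φ ∧′ ψ) x∉φ =
      cong₂ _∧′_ (substF-fresh φ (x∉φ ∘ inj₁)) (substF-fresh ψ (x∉φ ∘ inj₂))
    substF-fresh ([ α ] φ) x∉φ =
      cong₂ [_]_ (substP-fresh α (x∉φ ∘ inj₁)) (substF-fresh φ (x∉φ ∘ inj₂))

    substP-fresh : (α : Prog) → ¬ OccP x α → substP α ρ x ≡ α
    substP-fresh (act a) x∉α = refl
    substP-fresh (τ ¿) x∉α = cong _¿ (substF-fresh τ x∉α)
    substP-fresh (α ∪′ β) x∉α =
      cong₂ _∪′_ (substP-fresh α (x∉α ∘ inj₁)) (substP-fresh β (x∉α ∘ inj₂))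
    substP-fresh (α ⨾ β) x∉α =
      cong₂ _⨾_ (substP-fresh α (x∉α ∘ inj₁)) (substP-fresh β (x∉α ∘ inj₂))
    substP-fresh (α *) x∉α = cong _* (substP-fresh α x∉α)

  substF-var-self : substF (var x) ρ x ≡ ρ
  substF-var-self rewrite ≟-diag (refl {x = x}) = refl

-- Since truth of ρ is not decidable, each
-- state is paired with a decision of ρ there; building related paired states
-- therefore only succeeds under double negation, which is harmless because
-- truth is stable.
module Substitution (M : Model) (ρ : Fml) (x : Atom) where

  open RawMonad (¬¬-Monad {0ℓ})

  State : Set
  State = Σ (W M) (λ w → Dec (M , w ⊨ ρ))

  valuation : Atom → State → Bool
  valuation p (w , ρ?) with x ≟ p
  ... | yes _ = does ρ?
  ... | no _ = V M p w

  M[ρ/x] : Model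
  M[ρ/x] = record
    { W = State
    ; R = λ a s t → R M a (proj₁ s) (proj₁ t)
    ; V = valuation
    }

  mutual
    ⊨-to-substF : (φ : Fml) (s : State) → M[ρ/x] , s ⊨ φ → M , proj₁ s ⊨ substF φ ρ x
    ⊨-to-substF ⊥′ s ()
    ⊨-to-substF (var p) (w , yes ρw) h with x ≟ p
    ... | yes _ = ρw
    ... | no _ = h
    ⊨-to-substF (var p) (w , no _) h with x ≟ p
    ⊨-to-substF (var p) (w , no _) () | yes _
    ... | no _ = h
    ⊨-to-substF (¬′ φ) s ¬φ = ¬φ ∘ ⊨-from-substF φ s
    ⊨-to-substF (φ ∧′ ψ) s (hφ , hψ) = ⊨-to-substF φ s hφ , ⊨-to-substF ψ s hψ
    ⊨-to-substF ([ α ] φ) s □φ v r = ⊨-stable M v (substF φ ρ x) (do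
      (ρ? , r′) ← Rel-from-substP α s r
      pure (⊨-to-substF φ (v , ρ?) (□φ (v , ρ?) r′)))

    ⊨-from-substF : (φ : Fml) (s : State) → M , proj₁ s ⊨ substF φ ρ x → M[ρ/x] , s ⊨ φ
    ⊨-from-substF ⊥′ s ()
    ⊨-from-substF (var p) (w , ρ?) h with x ≟ p
    ... | yes _ = dec-true ρ? h
    ... | no _ = h
    ⊨-from-substF (¬′ φ) s ¬φ = ¬φ ∘ ⊨-to-substF φ s
    ⊨-from-substF (φ ∧′ ψ) s (hφ , hψ) = ⊨-from-substF φ s hφ , ⊨-from-substF ψ s hψ
    ⊨-from-substF ([ α ] φ) s □φ t r = ⊨-from-substF φ t (□φ (proj₁ t) (Rel-to-substP α s t r))

    Rel-to-substP : (α : Prog) (s t : State) →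
                    Rel M[ρ/x] α s t → Rel M (substP α ρ x) (proj₁ s) (proj₁ t)
    Rel-to-substP (act a) s t r = r
    Rel-to-substP (τ ¿) s t (s≡t , hτ) = cong proj₁ s≡t , ⊨-to-substF τ s hτ
    Rel-to-substP (α ∪′ β) s t (inj₁ r) = inj₁ (Rel-to-substP α s t r)
    Rel-to-substP (α ∪′ β) s t (inj₂ r) = inj₂ (Rel-to-substP β s t r)
    Rel-to-substP (α ⨾ β) s t (u , r₁ , r₂) =
      proj₁ u , Rel-to-substP α s u r₁ , Rel-to-substP β u t r₂
    Rel-to-substP (α *) s t rs = Star-to-substP α rs

    Star-to-substP : (α : Prog) {s t : State} →
                     Star (Rel M[ρ/x] α) s t → Star (Rel M (substP α ρ x)) (proj₁ s) (proj₁ t)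
    Star-to-substP α ε = ε
    Star-to-substP α (r ◅ rs) = Rel-to-substP α _ _ r ◅ Star-to-substP α rs

    Rel-from-substP : (α : Prog) (s : State) {v : W M} → Rel M (substP α ρ x) (proj₁ s) v →
                      ¬ ¬ Σ (Dec (M , v ⊨ ρ)) (λ ρ? → Rel M[ρ/x] α s (v , ρ?))
    Rel-from-substP (act a) s r = do
      ρ? ← ¬¬-excluded-middle
      pure (ρ? , r)
    Rel-from-substP (τ ¿) s (refl , hτ) = pure (proj₂ s , refl , ⊨-from-substF τ s hτ)
    Rel-from-substP (α ∪′ β) s (inj₁ r) = do
      (ρ? , r′) ← Rel-from-substP α s r
      pure (ρ? , inj₁ r′)
    Rel-from-substP (α ∪′ β) s (inj₂ r) = do
      (ρ? , r′) ← Rel-from-substP β s r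
      pure (ρ? , inj₂ r′)
    Rel-from-substP (α ⨾ β) s (u , r₁ , r₂) = do
      (ρ?ᵤ , r₁′) ← Rel-from-substP α s r₁
      (ρ? , r₂′) ← Rel-from-substP β (u , ρ?ᵤ) r₂
      pure (ρ? , (u , ρ?ᵤ) , r₁′ , r₂′)
    Rel-from-substP (α *) s rs = Star-from-substP α s rs

    Star-from-substP : (α : Prog) (s : State) {v : W M} → Star (Rel M (substP α ρ x)) (proj₁ s) v →
                       ¬ ¬ Σ (Dec (M , v ⊨ ρ)) (λ ρ? → Star (Rel M[ρ/x] α) s (v , ρ?))
    Star-from-substP α s ε = pure (proj₂ s , ε)
    Star-from-substP α s (r ◅ rs) = do
      (ρ?ᵤ , r′) ← Rel-from-substP α s r
      (ρ? , rs′) ← Star-from-substP α (_ , ρ?ᵤ) rs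
      pure (ρ? , r′ ◅ rs′)

substF-preserves-⊨ᶠ : (ρ : Fml) (x : Atom) (φ ψ : Fml) →
                      φ ⊨ᶠ ψ → substF φ ρ x ⊨ᶠ substF ψ ρ x
substF-preserves-⊨ᶠ ρ x φ ψ φ⊨ψ M w φ[ρ/x] = ⊨-stable M w (substF ψ ρ x) (do
    ρ? ← ¬¬-excluded-middle
    let s = w , ρ?
    pure (⊨-to-substF ψ s (φ⊨ψ M[ρ/x] s (⊨-from-substF φ s φ[ρ/x]))))
  where
  open Substitution M ρ x
  open RawMonad (¬¬-Monad {0ℓ})

diamond-prefixed : (χ₀ χ₁ : Fml) (β : Prog) (x : Atom) → ¬ OccP x β →
                   (¬′ ([ β ] (¬′ var x))) ⊨ᶠ ((var x ∧′ χ₀) ∨′ χ₁) →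
                   (ρ : Fml) → substF χ₁ ρ x ⊨ᶠ ρ → (¬′ ([ β ] (¬′ ρ))) ⊨ᶠ ρ
diamond-prefixed χ₀ χ₁ β x x∉β ⟨β⟩x⊨χ ρ χ₁[ρ/x]⊨ρ M u ⟨β⟩ρ =
  ⊨-stable M u ρ λ ¬ρ → ρ∧χ₀′∨χ₁′ (¬ρ ∘ subst (M , u ⊨_) (substF-var-self ρ x) ∘ proj₁ ,
                                    ¬ρ ∘ χ₁[ρ/x]⊨ρ M u)
  where
  ⟨β⟩x[ρ/x] : substF (¬′ ([ β ] (¬′ var x))) ρ x ≡ (¬′ ([ β ] (¬′ ρ)))
  ⟨β⟩x[ρ/x] = cong₂ (λ γ φ → ¬′ ([ γ ] (¬′ φ))) (substP-fresh ρ x β x∉β) (substF-var-self ρ x)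

  ρ∧χ₀′∨χ₁′ : M , u ⊨ substF ((var x ∧′ χ₀) ∨′ χ₁) ρ x
  ρ∧χ₀′∨χ₁′ = substF-preserves-⊨ᶠ ρ x (¬′ ([ β ] (¬′ var x))) ((var x ∧′ χ₀) ∨′ χ₁) ⟨β⟩x⊨χ
                M u (subst (M , u ⊨_) (sym ⟨β⟩x[ρ/x]) ⟨β⟩ρ)

lemma3p24 : (χ₀ χ₁ : Fml) (β : Prog) (x : Atom) →
    ¬ OccP x β →
    (¬′ ([ β ] (¬′ var x))) ≡ᶠ ((var x ∧′ χ₀) ∨′ χ₁) →
    (ρ ψ : Fml) →
    substF χ₁ ρ x ⊨ᶠ ρ →
    (¬′ ψ) ⊨ᶠ ρ →
    (¬′ ([ β * ] ψ)) ⊨ᶠ ρ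
lemma3p24 χ₀ χ₁ β x x∉β ⟨β⟩x≡χ ρ ψ χ₁[ρ/x]⊨ρ ¬ψ⊨ρ =
  star-induction β ρ ψ (diamond-prefixed χ₀ χ₁ β x x∉β (proj₁ ⟨β⟩x≡χ) ρ χ₁[ρ/x]⊨ρ) ¬ψ⊨ρ
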